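{- Quantified orthologic does not admit quantifier elimination. In particular, there is no quantifier-free formula $E$ such that both $E\vdash \bigvee x.\big(\neg x\land(y\lor x)\big)$ and $\bigvee x.\big(\neg x\land(y\lor x)\big)\vdash E$ are provable in the QOL sequent calculus.
   Context: Formulas of QOL are built from propositional variables, constants $0,1$, connectives $\land,\lor,\neg$, and quantifiers $\bigwedge x.\phi$, $\bigvee x.\phi$, identified up to alpha-equivalence; $\phi[x:=\psi]$ is capture-avoiding substitution. An annotated formula is $\phi^L$ or $\phi^R$; a sequent is a set of at most two annotated formulas; $\Gamma,\Delta$ denote sets of zero or one annotated formula. $\phi\vdash\psi$ means the sequent $\phi^L,\psi^R$ is derivable from the rules: Hyp: $\phi^L,\phi^R$. Cut: from $\Gamma,\psi^R$ and $\psi^L,\Delta$ infer $\Gamma,\Delta$. Weaken: from $\Gamma$ infer $\Gamma,\Delta$. LeftAnd: from $\Gamma,\phi^L$ infer $\Gamma,(\phi\land\psi)^L$. RightAnd: from $\Gamma,\phi^R$ and $\Gamma,\psi^R$ infer $\Gamma,(\phi\land\psi)^R$. LeftOr: from $\Gamma,\phi^L$ and $\Gamma,\psi^L$ infer $\Gamma,(\phi\lor\psi)^L$. RightOr: from $\Gamma,\phi^R$ infer $\Gamma,(\phi\lor\psi)^R$. LeftNot: from $\Gamma,\phi^R$ infer $\Gamma,(\neg\phi)^L$. RightNot: from $\Gamma,\phi^L$ infer $\Gamma,(\neg\phi)^R$. LeftForall: from $\Gamma,\phi[x:=\gamma]^L$ infer $\Gamma,(\bigwedge x.\phi)^L$.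 RightForall: from $\Gamma,\phi[x:=x']^R$, $x'$ not free in $\Gamma$, infer $\Gamma,(\bigwedge x.\phi)^R$. LeftExists: from $\Gamma,\phi[x:=x']^L$, $x'$ not free in $\Gamma$, infer $\Gamma,(\bigvee x.\phi)^L$. RightExists: from $\Gamma,\phi[x:=\gamma]^R$ infer $\Gamma,(\bigvee x.\phi)^R$. A quantified propositional logic admits quantifier elimination if for every formula $Q$ there is a quantifier-free formula $E$ with $Q\vdash E$ and $E\vdash Q$. -}

module Defs where

open import Data.Nat using (ℕ; zero; suc; _<_)
open import Data.Maybe using (Maybe; just; nothing)
open import Data.Product using (Σ; _×_)
open import Data.Unit using (⊤)
open import Data.Empty using (⊥)
open import Relation.Nullary using (¬_)
open import Relation.Binary.PropositionalEquality using (_≡_)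

-- Formulas of QOL in locally nameless representation (this realises
-- "identified up to alpha-equivalence"): free propositional variables are
-- named by ℕ ('fv'), bound variables are de Bruijn indices ('bv').
data Form : Set where
  fv   : ℕ → Form
  bv   : ℕ → Form
  𝟘 𝟙  : Form
  _∧_  : Form → Form → Form
  _∨_  : Form → Form → Form
  ¬'_  : Form → Form
  ⋀    : Form → Form      -- ⋀ x. φ  (x is de Bruijn index 0 in the body)
  ⋁    : Form → Form

infixr 6 _∧_
infixr 5 _∨_

data WS : ℕ → Form → Set where
  ws-fv  : ∀ {n x} → WS n (fv x)
  ws-bv  : ∀ {n i} → i < n → WS n (bv i)
  ws-0   : ∀ {n} → WS n 𝟘
  ws-1   : ∀ {n} → WS n 𝟙
  ws-∧   : ∀ {n φ ψ} → WS n φ → WS n ψ → WS n (φ ∧ ψ)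
  ws-∨   : ∀ {n φ ψ} → WS n φ → WS n ψ → WS n (φ ∨ ψ)
  ws-¬   : ∀ {n φ} → WS n φ → WS n (¬' φ)
  ws-⋀   : ∀ {n φ} → WS (suc n) φ → WS n (⋀ φ)
  ws-⋁   : ∀ {n φ} → WS (suc n) φ → WS n (⋁ φ)

LC : Form → Set
LC = WS 0

-- Opening: replace bound index k by the (locally closed) formula u.
-- Since u is locally closed, no shifting is needed; this is
-- capture-avoiding substitution φ[x:=u].
openAt : ℕ → Form → Form → Form
openAt k u (fv x) = fv x
openAt k u (bv i) with Data.Nat._≟_ k i
... | Relation.Nullary.yes _ = u
... | Relation.Nullary.no  _ = bv i
openAt k u 𝟘 = 𝟘
openAt k u 𝟙 = 𝟙
openAt k u (φ ∧ ψ) = openAt k u φ ∧ openAt k u ψ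
openAt k u (φ ∨ ψ) = openAt k u φ ∨ openAt k u ψ
openAt k u (¬' φ) = ¬' openAt k u φ
openAt k u (⋀ φ) = ⋀ (openAt (suc k) u φ)
openAt k u (⋁ φ) = ⋁ (openAt (suc k) u φ)

_[_] : Form → Form → Form
φ [ u ] = openAt 0 u φ

_#_ : ℕ → Form → Set
x # fv y = ¬ (x ≡ y)
x # bv i = ⊤
x # 𝟘 = ⊤
x # 𝟙 = ⊤
x # (φ ∧ ψ) = x # φ × x # ψ
x # (φ ∨ ψ) = x # φ × x # ψ
x # (¬' φ) = x # φ
x # (⋀ φ) = x # φ
x # (⋁ φ) = x # φ

data AF : Set where
  _ᴸ _ᴿ : Form → AF

formOf : AF → Form
formOf (φ ᴸ) = φ
formOf (φ ᴿ) = φ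

Opt : Set
Opt = Maybe AF

_#ᵒ_ : ℕ → Opt → Set
x #ᵒ nothing = ⊤
x #ᵒ just a = x # formOf a

-- Derivability of the sequent Γ,Δ (the set Γ ∪ Δ of at most two annotated
-- formulas).  Since a sequent is a *set*, the order of Γ and Δ is
-- irrelevant ('exch') and {a} ∪ {a} = {a} ('dup', 'undup').
data ⊢_,_ : Opt → Opt → Set where
  exch   : ∀ {Γ Δ} → ⊢ Γ , Δ → ⊢ Δ , Γ
  dup    : ∀ {a} → ⊢ just a , nothing → ⊢ just a , just a
  undup  : ∀ {a} → ⊢ just a , just a → ⊢ just a , nothing
  hyp    : ∀ {φ} → ⊢ just (φ ᴸ) , just (φ ᴿ)
  cut    : ∀ {Γ Δ ψ} → ⊢ Γ , just (ψ ᴿ) → ⊢ just (ψ ᴸ) , Δ → ⊢ Γ , Δ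
  weaken : ∀ {Γ Δ} → ⊢ Γ , nothing → ⊢ Γ , Δ
  leftAnd  : ∀ {Γ φ ψ} → ⊢ Γ , just (φ ᴸ) → ⊢ Γ , just ((φ ∧ ψ) ᴸ)
  leftAnd' : ∀ {Γ φ ψ} → ⊢ Γ , just (ψ ᴸ) → ⊢ Γ , just ((φ ∧ ψ) ᴸ)
  rightAnd : ∀ {Γ φ ψ} → ⊢ Γ , just (φ ᴿ) → ⊢ Γ , just (ψ ᴿ) → ⊢ Γ , just ((φ ∧ ψ) ᴿ)
  leftOr   : ∀ {Γ φ ψ} → ⊢ Γ , just (φ ᴸ) → ⊢ Γ , just (ψ ᴸ) → ⊢ Γ , just ((φ ∨ ψ) ᴸ)
  rightOr  : ∀ {Γ φ ψ} → ⊢ Γ , just (φ ᴿ) → ⊢ Γ , just ((φ ∨ ψ) ᴿ)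
  rightOr' : ∀ {Γ φ ψ} → ⊢ Γ , just (ψ ᴿ) → ⊢ Γ , just ((φ ∨ ψ) ᴿ)
  leftNot  : ∀ {Γ φ} → ⊢ Γ , just (φ ᴿ) → ⊢ Γ , just ((¬' φ) ᴸ)
  rightNot : ∀ {Γ φ} → ⊢ Γ , just (φ ᴸ) → ⊢ Γ , just ((¬' φ) ᴿ)
  leftForall  : ∀ {Γ φ γ} → LC γ → ⊢ Γ , just ((φ [ γ ]) ᴸ) → ⊢ Γ , just ((⋀ φ) ᴸ)
  rightForall : ∀ {Γ φ x'} → x' #ᵒ Γ → x' # φ → ⊢ Γ , just ((φ [ fv x' ]) ᴿ) → ⊢ Γ , just ((⋀ φ) ᴿ)
  leftExists  : ∀ {Γ φ x'} → x' #ᵒ Γ → x' # φ → ⊢ Γ , just ((φ [ fv x' ]) ᴸ) → ⊢ Γ , just ((⋁ φ) ᴸ)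
  rightExists : ∀ {Γ φ γ} → LC γ → ⊢ Γ , just ((φ [ γ ]) ᴿ) → ⊢ Γ , just ((⋁ φ) ᴿ)

_⊢_ : Form → Form → Set
φ ⊢ ψ = ⊢ just (φ ᴸ) , just (ψ ᴿ)

data QF : Form → Set where
  qf-fv : ∀ {x} → QF (fv x)
  qf-bv : ∀ {i} → QF (bv i)
  qf-0  : QF 𝟘
  qf-1  : QF 𝟙
  qf-∧  : ∀ {φ ψ} → QF φ → QF ψ → QF (φ ∧ ψ)
  qf-∨  : ∀ {φ ψ} → QF φ → QF ψ → QF (φ ∨ ψ)
  qf-¬  : ∀ {φ} → QF φ → QF (¬' φ)

AdmitsQE : Set
AdmitsQE = (Q : Form) → LC Q → Σ Form λ E → LC E × QF E × (Q ⊢ E) × (E ⊢ Q)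

y : Form
y = fv 0

Qex : Form
Qex = ⋁ ((¬' bv 0) ∧ (y ∨ bv 0))

{-# OPTIONS --safe #-}
module Submission where

-- QOL is sound for complete ortholattices when a sequent {A, B} is read as
-- A ᶜ ≤ B.  Take the hexagon ortholattice O₆, made of the two chains
-- ⊥ < a < b < ⊤ and ⊥ < bᶜ < aᶜ < ⊤, and value every free variable at a.
-- Then ⋁x.(¬x ∧ (y ∨ x)) denotes b (the join is attained at x = bᶜ), whereas
-- a quantifier-free formula can only denote an element of the Boolean
-- subalgebra {⊥, a, aᶜ, ⊤} generated by a.

open import Defs
open import Level using (0ℓ)
open import Algebra.Core using (Op₁; Op₂)
open import Data.Bool.Base using (Bool; true; false; T)
open import Data.Fin.Base using (Fin; zero; suc)
open import Data.Fin.Properties using (all?) renaming (_≟_ to _≟ᶠ_)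
open import Data.List.Base using (List; []; _∷_; _++_; length; foldr; map; allFin)
open import Data.List.Membership.Propositional using (_∈_)
open import Data.List.Membership.Propositional.Properties using (∈-allFin)
open import Data.List.Relation.Unary.Any using (here; there)
open import Data.Maybe.Base using (just; nothing)
open import Data.Nat.Base using (ℕ; zero; suc; _<_; s≤s; z≤n)
open import Data.Nat.Properties using (_≟_)
open import Data.Product.Base using (Σ; _×_; _,_)
open import Data.Unit.Base using (tt)
open import Function.Base using (_∘_)
open import Relation.Binary.Core using (Rel)
open import Relation.Binary.Definitions using (Decidable; Reflexive; Transitive; Antisymmetric)
open import Relation.Binary.Lattice.Definitions using (Supremum; Infimum)
open import Relation.Binary.Lattice.Structures using (IsBoundedLattice)
open import Relation.Binary.PropositionalEquality
  using (_≡_; _≢_; refl; sym; trans; cong; cong₂; subst; subst₂; isEquivalence; module ≡-Reasoning)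
open import Relation.Nullary using (¬_; Dec; yes; no; contradiction)
open import Relation.Nullary.Decidable using (from-yes; T?; _×-dec_; _→-dec_)

record Ortholattice : Set₁ where
  infix  4 _≤_
  infixr 6 _⊔_
  infixr 7 _⊓_
  infix  8 _ᶜ
  field
    Carrier          : Set
    _≤_              : Rel Carrier 0ℓ
    _⊔_ _⊓_          : Op₂ Carrier
    ⊤ ⊥              : Carrier
    _ᶜ               : Op₁ Carrier
    isBoundedLattice : IsBoundedLattice _≡_ _≤_ _⊔_ _⊓_ ⊤ ⊥
    ᶜ-antitone       : ∀ {x y} → x ≤ y → y ᶜ ≤ x ᶜ
    ᶜ-involutive     : ∀ x → x ᶜ ᶜ ≡ x
    x⊓xᶜ≤⊥           : ∀ x → x ⊓ x ᶜ ≤ ⊥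

  open IsBoundedLattice isBoundedLattice public
    renaming (refl to ≤-refl; reflexive to ≤-reflexive; trans to ≤-trans; antisym to ≤-antisym)

record IsSubortholattice (L : Ortholattice) (P : Ortholattice.Carrier L → Set) : Set where
  open Ortholattice L
  field
    ⊤-closed : P ⊤
    ⊥-closed : P ⊥
    ⊔-closed : ∀ {x y} → P x → P y → P (x ⊔ y)
    ⊓-closed : ∀ {x y} → P x → P y → P (x ⊓ y)
    ᶜ-closed : ∀ {x} → P x → P (x ᶜ)

-- Only joins of families indexed by the carrier itself are required: these
-- are what the quantifiers of QOL range over.
record CompleteOrtholattice : Set₁ where
  field
    ortholattice : Ortholattice

  open Ortholattice ortholattice public

  field
    ⨆       : (Carrier → Carrier) → Carrier
    ⨆-upper : ∀ f x → f x ≤ ⨆ f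
    ⨆-least : ∀ f {z} → (∀ x → f x ≤ z) → ⨆ f ≤ z

module OrtholatticeProperties (L : Ortholattice) where
  open Ortholattice L

  xᶜ≤y⇒yᶜ≤x : ∀ {x y} → x ᶜ ≤ y → y ᶜ ≤ x
  xᶜ≤y⇒yᶜ≤x {x} xᶜ≤y = subst (_ ≤_) (ᶜ-involutive x) (ᶜ-antitone xᶜ≤y)

  x≤yᶜ⇒y≤xᶜ : ∀ {x y} → x ≤ y ᶜ → y ≤ x ᶜ
  x≤yᶜ⇒y≤xᶜ {y = y} x≤yᶜ = subst (_≤ _) (ᶜ-involutive y) (ᶜ-antitone x≤yᶜ)

  xᶜ≤x⇒xᶜ≤⊥ : ∀ {x} → x ᶜ ≤ x → x ᶜ ≤ ⊥
  xᶜ≤x⇒xᶜ≤⊥ {x} xᶜ≤x = ≤-trans (∧-greatest xᶜ≤x ≤-refl) (x⊓xᶜ≤⊥ x)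

  ≤ᶜ-⊔ : ∀ {x y z} → x ≤ y ᶜ → x ≤ z ᶜ → x ≤ (y ⊔ z) ᶜ
  ≤ᶜ-⊔ x≤yᶜ x≤zᶜ = x≤yᶜ⇒y≤xᶜ (∨-least (x≤yᶜ⇒y≤xᶜ x≤yᶜ) (x≤yᶜ⇒y≤xᶜ x≤zᶜ))

  foldr-⊔-upper : ∀ {A : Set} (f : A → Carrier) {x xs} → x ∈ xs → f x ≤ foldr _⊔_ ⊥ (map f xs)
  foldr-⊔-upper f (here refl) = x≤x∨y _ _
  foldr-⊔-upper f (there x∈xs) = ≤-trans (foldr-⊔-upper f x∈xs) (y≤x∨y _ _)

  foldr-⊔-least : ∀ {A : Set} (f : A → Carrier) xs {z} → (∀ x → f x ≤ z) → foldr _⊔_ ⊥ (map f xs) ≤ z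
  foldr-⊔-least f []       f≤z = minimum _
  foldr-⊔-least f (x ∷ xs) f≤z = ∨-least (f≤z x) (foldr-⊔-least f xs f≤z)

finite⇒complete : (L : Ortholattice) (xs : List (Ortholattice.Carrier L)) →
                  (∀ x → x ∈ xs) → CompleteOrtholattice
finite⇒complete L xs enumerates = record
  { ortholattice = L
  ; ⨆            = λ f → foldr _⊔_ ⊥ (map f xs)
  ; ⨆-upper      = λ f x → foldr-⊔-upper f (enumerates x)
  ; ⨆-least      = λ f → foldr-⊔-least f xs
  }
  where
  open Ortholattice L
  open OrtholatticeProperties L

module CompleteOrtholatticeProperties (L : CompleteOrtholattice) where
  open CompleteOrtholattice L
  open OrtholatticeProperties ortholattice public

  ⨆-cong : ∀ {f g} → (∀ x → f x ≡ g x) → ⨆ f ≡ ⨆ g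
  ⨆-cong {f} {g} f≗g =
    ≤-antisym (⨆-least f λ x → ≤-trans (≤-reflexive (f≗g x)) (⨆-upper g x))
              (⨆-least g λ x → ≤-trans (≤-reflexive (sym (f≗g x))) (⨆-upper f x))

  ⨅ : (Carrier → Carrier) → Carrier
  ⨅ f = (⨆ λ x → f x ᶜ) ᶜ

  ⨅-cong : ∀ {f g} → (∀ x → f x ≡ g x) → ⨅ f ≡ ⨅ g
  ⨅-cong f≗g = cong _ᶜ (⨆-cong (cong _ᶜ ∘ f≗g))

  ⨅-lower : ∀ f x → ⨅ f ≤ f x
  ⨅-lower f x = xᶜ≤y⇒yᶜ≤x (⨆-upper (λ x → f x ᶜ) x)

  ⨅-greatest : ∀ f {z} → (∀ x → z ≤ f x) → z ≤ ⨅ f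
  ⨅-greatest f z≤f = x≤yᶜ⇒y≤xᶜ (⨆-least (λ x → f x ᶜ) (ᶜ-antitone ∘ z≤f))

  ≤ᶜ-⨆ : ∀ f {z} → (∀ x → z ≤ f x ᶜ) → z ≤ (⨆ f) ᶜ
  ≤ᶜ-⨆ f z≤fᶜ = x≤yᶜ⇒y≤xᶜ (⨆-least f (x≤yᶜ⇒y≤xᶜ ∘ z≤fᶜ))

module Semantics (L : CompleteOrtholattice) where
  open CompleteOrtholattice L
  open CompleteOrtholatticeProperties L

  Valuation : Set
  Valuation = ℕ → Carrier

  -- Dangling bound indices, which only occur in formulas that are not well
  -- scoped, denote ⊥.
  _‼_ : List Carrier → ℕ → Carrier
  []      ‼ i     = ⊥
  (v ∷ σ) ‼ zero  = v
  (v ∷ σ) ‼ suc i = σ ‼ i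

  ⟦_⟧ : Form → Valuation → List Carrier → Carrier
  ⟦ fv x ⟧  ρ σ = ρ x
  ⟦ bv i ⟧  ρ σ = σ ‼ i
  ⟦ 𝟘 ⟧     ρ σ = ⊥
  ⟦ 𝟙 ⟧     ρ σ = ⊤
  ⟦ φ ∧ ψ ⟧ ρ σ = ⟦ φ ⟧ ρ σ ⊓ ⟦ ψ ⟧ ρ σ
  ⟦ φ ∨ ψ ⟧ ρ σ = ⟦ φ ⟧ ρ σ ⊔ ⟦ ψ ⟧ ρ σ
  ⟦ ¬' φ ⟧  ρ σ = ⟦ φ ⟧ ρ σ ᶜ
  ⟦ ⋀ φ ⟧   ρ σ = ⨅ λ v → ⟦ φ ⟧ ρ (v ∷ σ)
  ⟦ ⋁ φ ⟧   ρ σ = ⨆ λ v → ⟦ φ ⟧ ρ (v ∷ σ)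

  ‼-++ : ∀ σ τ {i} → i < length σ → (σ ++ τ) ‼ i ≡ σ ‼ i
  ‼-++ (v ∷ σ) τ {zero}  _         = refl
  ‼-++ (v ∷ σ) τ {suc i} (s≤s i<n) = ‼-++ σ τ i<n

  ⟦⟧-++ : ∀ {φ} ρ σ τ → WS (length σ) φ → ⟦ φ ⟧ ρ (σ ++ τ) ≡ ⟦ φ ⟧ ρ σ
  ⟦⟧-++ ρ σ τ ws-fv         = refl
  ⟦⟧-++ ρ σ τ (ws-bv i<n)   = ‼-++ σ τ i<n
  ⟦⟧-++ ρ σ τ ws-0          = refl
  ⟦⟧-++ ρ σ τ ws-1          = refl
  ⟦⟧-++ ρ σ τ (ws-∧ wφ wψ)  = cong₂ _⊓_ (⟦⟧-++ ρ σ τ wφ) (⟦⟧-++ ρ σ τ wψ)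
  ⟦⟧-++ ρ σ τ (ws-∨ wφ wψ)  = cong₂ _⊔_ (⟦⟧-++ ρ σ τ wφ) (⟦⟧-++ ρ σ τ wψ)
  ⟦⟧-++ ρ σ τ (ws-¬ wφ)     = cong _ᶜ (⟦⟧-++ ρ σ τ wφ)
  ⟦⟧-++ ρ σ τ (ws-⋀ wφ)     = ⨅-cong λ v → ⟦⟧-++ ρ (v ∷ σ) τ wφ
  ⟦⟧-++ ρ σ τ (ws-⋁ wφ)     = ⨆-cong λ v → ⟦⟧-++ ρ (v ∷ σ) τ wφ

  ⟦⟧-closed : ∀ {u} ρ σ → LC u → ⟦ u ⟧ ρ σ ≡ ⟦ u ⟧ ρ []
  ⟦⟧-closed ρ σ = ⟦⟧-++ ρ [] σ

  ‼-snoc : ∀ σ v → (σ ++ v ∷ []) ‼ length σ ≡ v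
  ‼-snoc []      v = refl
  ‼-snoc (w ∷ σ) v = ‼-snoc σ v

  ‼-snoc-≢ : ∀ σ v {i} → length σ ≢ i → (σ ++ v ∷ []) ‼ i ≡ σ ‼ i
  ‼-snoc-≢ []      v {zero}  ≢i = contradiction refl ≢i
  ‼-snoc-≢ []      v {suc i} _  = refl
  ‼-snoc-≢ (w ∷ σ) v {zero}  _  = refl
  ‼-snoc-≢ (w ∷ σ) v {suc i} ≢i = ‼-snoc-≢ σ v (≢i ∘ cong suc)

  ⟦⟧-openAt : ∀ {u} ρ → LC u → ∀ φ σ →
              ⟦ openAt (length σ) u φ ⟧ ρ σ ≡ ⟦ φ ⟧ ρ (σ ++ ⟦ u ⟧ ρ [] ∷ [])
  ⟦⟧-openAt ρ lc (fv x)  σ = refl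
  ⟦⟧-openAt ρ lc (bv i)  σ with length σ ≟ i
  ... | yes refl = trans (⟦⟧-closed ρ σ lc) (sym (‼-snoc σ _))
  ... | no  ≢i   = sym (‼-snoc-≢ σ _ ≢i)
  ⟦⟧-openAt ρ lc 𝟘       σ = refl
  ⟦⟧-openAt ρ lc 𝟙       σ = refl
  ⟦⟧-openAt ρ lc (φ ∧ ψ) σ = cong₂ _⊓_ (⟦⟧-openAt ρ lc φ σ) (⟦⟧-openAt ρ lc ψ σ)
  ⟦⟧-openAt ρ lc (φ ∨ ψ) σ = cong₂ _⊔_ (⟦⟧-openAt ρ lc φ σ) (⟦⟧-openAt ρ lc ψ σ)
  ⟦⟧-openAt ρ lc (¬' φ)  σ = cong _ᶜ (⟦⟧-openAt ρ lc φ σ)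
  ⟦⟧-openAt ρ lc (⋀ φ)   σ = ⨅-cong λ v → ⟦⟧-openAt ρ lc φ (v ∷ σ)
  ⟦⟧-openAt ρ lc (⋁ φ)   σ = ⨆-cong λ v → ⟦⟧-openAt ρ lc φ (v ∷ σ)

  ⟦⟧-instantiate : ∀ {γ} ρ φ → LC γ → ⟦ φ [ γ ] ⟧ ρ [] ≡ ⟦ φ ⟧ ρ (⟦ γ ⟧ ρ [] ∷ [])
  ⟦⟧-instantiate ρ φ lc = ⟦⟧-openAt ρ lc φ []

  _⟨_≔_⟩ : Valuation → ℕ → Carrier → Valuation
  (ρ ⟨ x ≔ v ⟩) x' with x ≟ x'
  ... | yes _ = v
  ... | no  _ = ρ x'

  ⟨≔⟩-same : ∀ ρ x v → (ρ ⟨ x ≔ v ⟩) x ≡ v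
  ⟨≔⟩-same ρ x v with x ≟ x
  ... | yes _  = refl
  ... | no x≢x = contradiction refl x≢x

  ⟦⟧-fresh : ∀ ρ {x} v φ σ → x # φ → ⟦ φ ⟧ (ρ ⟨ x ≔ v ⟩) σ ≡ ⟦ φ ⟧ ρ σ
  ⟦⟧-fresh ρ {x} v (fv x') σ x≢x' with x ≟ x'
  ... | yes x≡x' = contradiction x≡x' x≢x'
  ... | no  _    = refl
  ⟦⟧-fresh ρ v (bv i)  σ _           = refl
  ⟦⟧-fresh ρ v 𝟘       σ _           = refl
  ⟦⟧-fresh ρ v 𝟙       σ _           = refl
  ⟦⟧-fresh ρ v (φ ∧ ψ) σ (x#φ , x#ψ) = cong₂ _⊓_ (⟦⟧-fresh ρ v φ σ x#φ) (⟦⟧-fresh ρ v ψ σ x#ψ)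
  ⟦⟧-fresh ρ v (φ ∨ ψ) σ (x#φ , x#ψ) = cong₂ _⊔_ (⟦⟧-fresh ρ v φ σ x#φ) (⟦⟧-fresh ρ v ψ σ x#ψ)
  ⟦⟧-fresh ρ v (¬' φ)  σ x#φ         = cong _ᶜ (⟦⟧-fresh ρ v φ σ x#φ)
  ⟦⟧-fresh ρ v (⋀ φ)   σ x#φ         = ⨅-cong λ w → ⟦⟧-fresh ρ v φ (w ∷ σ) x#φ
  ⟦⟧-fresh ρ v (⋁ φ)   σ x#φ         = ⨆-cong λ w → ⟦⟧-fresh ρ v φ (w ∷ σ) x#φ

  ⟦⟧-instantiate-fresh : ∀ ρ {x} v φ → x # φ →
                         ⟦ φ [ fv x ] ⟧ (ρ ⟨ x ≔ v ⟩) [] ≡ ⟦ φ ⟧ ρ (v ∷ [])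
  ⟦⟧-instantiate-fresh ρ {x} v φ x#φ = begin
    ⟦ φ [ fv x ] ⟧ (ρ ⟨ x ≔ v ⟩) []                ≡⟨ ⟦⟧-instantiate _ φ ws-fv ⟩
    ⟦ φ ⟧ (ρ ⟨ x ≔ v ⟩) ((ρ ⟨ x ≔ v ⟩) x ∷ [])     ≡⟨ cong (λ w → ⟦ φ ⟧ (ρ ⟨ x ≔ v ⟩) (w ∷ [])) (⟨≔⟩-same ρ x v) ⟩
    ⟦ φ ⟧ (ρ ⟨ x ≔ v ⟩) (v ∷ [])                   ≡⟨ ⟦⟧-fresh ρ v φ _ x#φ ⟩
    ⟦ φ ⟧ ρ (v ∷ [])                               ∎
    where open ≡-Reasoning

  ⟦_⟧ᵃ : AF → Valuation → Carrier
  ⟦ φ ᴸ ⟧ᵃ ρ = ⟦ φ ⟧ ρ [] ᶜ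
  ⟦ φ ᴿ ⟧ᵃ ρ = ⟦ φ ⟧ ρ []

  ⟦_⟧ᵒ : Opt → Valuation → Carrier
  ⟦ nothing ⟧ᵒ ρ = ⊥
  ⟦ just A ⟧ᵒ  ρ = ⟦ A ⟧ᵃ ρ

  ⟦⟧ᵒ-fresh : ∀ ρ {x} v Γ → x #ᵒ Γ → ⟦ Γ ⟧ᵒ (ρ ⟨ x ≔ v ⟩) ≡ ⟦ Γ ⟧ᵒ ρ
  ⟦⟧ᵒ-fresh ρ v nothing      _   = refl
  ⟦⟧ᵒ-fresh ρ v (just (φ ᴸ)) x#φ = cong _ᶜ (⟦⟧-fresh ρ v φ [] x#φ)
  ⟦⟧ᵒ-fresh ρ v (just (φ ᴿ)) x#φ = ⟦⟧-fresh ρ v φ [] x#φ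

  -- Without distributivity this is stronger than ⟦ Γ ⟧ᵒ ρ ⊔ ⟦ Δ ⟧ᵒ ρ ≡ ⊤;
  -- it is symmetric in Γ and Δ by contraposition.
  Valid : Opt → Opt → Set
  Valid Γ Δ = ∀ ρ → ⟦ Γ ⟧ᵒ ρ ᶜ ≤ ⟦ Δ ⟧ᵒ ρ

  soundness : ∀ {Γ Δ} → ⊢ Γ , Δ → Valid Γ Δ
  soundness (exch d)       ρ = xᶜ≤y⇒yᶜ≤x (soundness d ρ)
  soundness (dup d)        ρ = ≤-trans (soundness d ρ) (minimum _)
  soundness (undup d)      ρ = xᶜ≤x⇒xᶜ≤⊥ (soundness d ρ)
  soundness hyp            ρ = ≤-reflexive (ᶜ-involutive _)
  soundness (cut d e)      ρ = ≤-trans (soundness d ρ) (subst (_≤ _) (ᶜ-involutive _) (soundness e ρ))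
  soundness (weaken d)     ρ = ≤-trans (soundness d ρ) (minimum _)
  soundness (leftAnd d)    ρ = ≤-trans (soundness d ρ) (ᶜ-antitone (x∧y≤x _ _))
  soundness (leftAnd' d)   ρ = ≤-trans (soundness d ρ) (ᶜ-antitone (x∧y≤y _ _))
  soundness (rightAnd d e) ρ = ∧-greatest (soundness d ρ) (soundness e ρ)
  soundness (leftOr d e)   ρ = ≤ᶜ-⊔ (soundness d ρ) (soundness e ρ)
  soundness (rightOr d)    ρ = ≤-trans (soundness d ρ) (x≤x∨y _ _)
  soundness (rightOr' d)   ρ = ≤-trans (soundness d ρ) (y≤x∨y _ _)
  soundness (leftNot d)    ρ = subst (_ ≤_) (sym (ᶜ-involutive _)) (soundness d ρ)
  soundness (rightNot d)   ρ = soundness d ρ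
  soundness (leftForall {φ = φ} lc d) ρ =
    ≤-trans (subst (λ t → _ ≤ t ᶜ) (⟦⟧-instantiate ρ φ lc) (soundness d ρ)) (ᶜ-antitone (⨅-lower _ _))
  soundness (rightExists {φ = φ} lc d) ρ =
    ≤-trans (subst (_ ≤_) (⟦⟧-instantiate ρ φ lc) (soundness d ρ)) (⨆-upper _ _)
  soundness (rightForall {Γ} {φ} {x} x#Γ x#φ d) ρ = ⨅-greatest _ λ v →
    subst₂ (λ g t → g ᶜ ≤ t) (⟦⟧ᵒ-fresh ρ v Γ x#Γ) (⟦⟧-instantiate-fresh ρ v φ x#φ) (soundness d (ρ ⟨ x ≔ v ⟩))
  soundness (leftExists {Γ} {φ} {x} x#Γ x#φ d) ρ = ≤ᶜ-⨆ _ λ v →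
    subst₂ (λ g t → g ᶜ ≤ t ᶜ) (⟦⟧ᵒ-fresh ρ v Γ x#Γ) (⟦⟧-instantiate-fresh ρ v φ x#φ) (soundness d (ρ ⟨ x ≔ v ⟩))

  ⊢-sound : ∀ {φ ψ} → φ ⊢ ψ → ∀ ρ → ⟦ φ ⟧ ρ [] ≤ ⟦ ψ ⟧ ρ []
  ⊢-sound d ρ = subst (_≤ _) (ᶜ-involutive _) (soundness d ρ)

  module _ {P} (sub : IsSubortholattice ortholattice P) (ρ : Valuation) (Pρ : ∀ x → P (ρ x)) where
    open IsSubortholattice sub

    ⟦⟧-QF-closed : ∀ {E} → QF E → P (⟦ E ⟧ ρ [])
    ⟦⟧-QF-closed qf-fv        = Pρ _
    ⟦⟧-QF-closed qf-bv        = ⊥-closed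
    ⟦⟧-QF-closed qf-0         = ⊥-closed
    ⟦⟧-QF-closed qf-1         = ⊤-closed
    ⟦⟧-QF-closed (qf-∧ qφ qψ) = ⊓-closed (⟦⟧-QF-closed qφ) (⟦⟧-QF-closed qψ)
    ⟦⟧-QF-closed (qf-∨ qφ qψ) = ⊔-closed (⟦⟧-QF-closed qφ) (⟦⟧-QF-closed qψ)
    ⟦⟧-QF-closed (qf-¬ qφ)    = ᶜ-closed (⟦⟧-QF-closed qφ)

pattern bot = zero
pattern a   = suc zero
pattern b   = suc (suc zero)
pattern aᶜ  = suc (suc (suc zero))
pattern bᶜ  = suc (suc (suc (suc zero)))
pattern top = suc (suc (suc (suc (suc zero))))

infix  4 _≤₆_
infixr 6 _⊔₆_
infixr 7 _⊓₆_
infix  8 _ᶜ₆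

leq₆ : Fin 6 → Fin 6 → Bool
leq₆ bot _   = true
leq₆ _   top = true
leq₆ a   a   = true
leq₆ a   b   = true
leq₆ b   b   = true
leq₆ bᶜ  bᶜ  = true
leq₆ bᶜ  aᶜ  = true
leq₆ aᶜ  aᶜ  = true
leq₆ _   _   = false

_≤₆_ : Rel (Fin 6) 0ℓ
x ≤₆ y = T (leq₆ x y)

_ᶜ₆ : Op₁ (Fin 6)
bot ᶜ₆ = top
a   ᶜ₆ = aᶜ
b   ᶜ₆ = bᶜ
aᶜ  ᶜ₆ = a
bᶜ  ᶜ₆ = b
top ᶜ₆ = bot

_⊔₆_ : Op₂ (Fin 6)
bot ⊔₆ y   = y
x   ⊔₆ bot = x
a   ⊔₆ a   = a
a   ⊔₆ b   = b
b   ⊔₆ a   = b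
b   ⊔₆ b   = b
bᶜ  ⊔₆ bᶜ  = bᶜ
bᶜ  ⊔₆ aᶜ  = aᶜ
aᶜ  ⊔₆ bᶜ  = aᶜ
aᶜ  ⊔₆ aᶜ  = aᶜ
_   ⊔₆ _   = top

_⊓₆_ : Op₂ (Fin 6)
x ⊓₆ y = (x ᶜ₆ ⊔₆ y ᶜ₆) ᶜ₆

infix 4 _≤₆?_
_≤₆?_ : Decidable _≤₆_
x ≤₆? y = T? (leq₆ x y)

≤₆-refl : Reflexive _≤₆_
≤₆-refl {x} = from-yes (all? λ x → x ≤₆? x) x

≤₆-trans : Transitive _≤₆_
≤₆-trans {x} {y} {z} =
  from-yes (all? λ x → all? λ y → all? λ z → x ≤₆? y →-dec y ≤₆? z →-dec x ≤₆? z) x y z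

≤₆-antisym : Antisymmetric _≡_ _≤₆_
≤₆-antisym {x} {y} = from-yes (all? λ x → all? λ y → x ≤₆? y →-dec y ≤₆? x →-dec x ≟ᶠ y) x y

⊔₆-supremum : Supremum _≤₆_ _⊔₆_
⊔₆-supremum = from-yes (all? λ x → all? λ y →
  x ≤₆? x ⊔₆ y ×-dec y ≤₆? x ⊔₆ y ×-dec all? λ z → x ≤₆? z →-dec y ≤₆? z →-dec x ⊔₆ y ≤₆? z)

⊓₆-infimum : Infimum _≤₆_ _⊓₆_
⊓₆-infimum = from-yes (all? λ x → all? λ y →
  x ⊓₆ y ≤₆? x ×-dec x ⊓₆ y ≤₆? y ×-dec all? λ z → z ≤₆? x →-dec z ≤₆? y →-dec z ≤₆? x ⊓₆ y)

O₆-ortholattice : Ortholattice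
O₆-ortholattice = record
  { Carrier          = Fin 6
  ; _≤_              = _≤₆_
  ; _⊔_              = _⊔₆_
  ; _⊓_              = _⊓₆_
  ; ⊤                = top
  ; ⊥                = bot
  ; _ᶜ               = _ᶜ₆
  ; isBoundedLattice = record
    { isLattice = record
      { isPartialOrder = record
        { isPreorder = record
          { isEquivalence = isEquivalence
          ; reflexive     = λ { refl → ≤₆-refl }
          ; trans         = ≤₆-trans
          }
        ; antisym = ≤₆-antisym
        }
      ; supremum = ⊔₆-supremum
      ; infimum  = ⊓₆-infimum
      }
    ; maximum = from-yes (all? λ x → x ≤₆? top)
    ; minimum = λ _ → tt
    }
  ; ᶜ-antitone   = λ {x y} → from-yes (all? λ x → all? λ y → x ≤₆? y →-dec y ᶜ₆ ≤₆? x ᶜ₆) x y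
  ; ᶜ-involutive = from-yes (all? λ x → x ᶜ₆ ᶜ₆ ≟ᶠ x)
  ; x⊓xᶜ≤⊥       = from-yes (all? λ x → x ⊓₆ x ᶜ₆ ≤₆? bot)
  }

O₆ : CompleteOrtholattice
O₆ = finite⇒complete O₆-ortholattice (allFin 6) ∈-allFin

is⟨a⟩ : Fin 6 → Bool
is⟨a⟩ b  = false
is⟨a⟩ bᶜ = false
is⟨a⟩ _  = true

⟨a⟩ : Fin 6 → Set
⟨a⟩ x = T (is⟨a⟩ x)

⟨a⟩? : ∀ x → Dec (⟨a⟩ x)
⟨a⟩? x = T? (is⟨a⟩ x)

⟨a⟩-isSubortholattice : IsSubortholattice O₆-ortholattice ⟨a⟩
⟨a⟩-isSubortholattice = record
  { ⊤-closed = tt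
  ; ⊥-closed = tt
  ; ⊔-closed = λ {x y} → from-yes (all? λ x → all? λ y → ⟨a⟩? x →-dec ⟨a⟩? y →-dec ⟨a⟩? (x ⊔₆ y)) x y
  ; ⊓-closed = λ {x y} → from-yes (all? λ x → all? λ y → ⟨a⟩? x →-dec ⟨a⟩? y →-dec ⟨a⟩? (x ⊓₆ y)) x y
  ; ᶜ-closed = λ {x} → from-yes (all? λ x → ⟨a⟩? x →-dec ⟨a⟩? (x ᶜ₆)) x
  }

open Semantics O₆ using (Valuation; ⟦_⟧; ⊢-sound; ⟦⟧-QF-closed)

ρₐ : Valuation
ρₐ _ = a

Qex-denotes-b : ⟦ Qex ⟧ ρₐ [] ≡ b
Qex-denotes-b = refl

no-quantifier-free-equivalent : ¬ (Σ Form λ E → LC E × QF E × (E ⊢ Qex) × (Qex ⊢ E))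
no-quantifier-free-equivalent (E , _ , qf , E⊢Qex , Qex⊢E) =
  subst ⟨a⟩ (trans E≡Qex Qex-denotes-b) (⟦⟧-QF-closed ⟨a⟩-isSubortholattice ρₐ (λ _ → tt) qf)
  where
  E≡Qex : ⟦ E ⟧ ρₐ [] ≡ ⟦ Qex ⟧ ρₐ []
  E≡Qex = ≤₆-antisym (⊢-sound E⊢Qex ρₐ) (⊢-sound Qex⊢E ρₐ)

Qex-closed : LC Qex
Qex-closed = ws-⋁ (ws-∧ (ws-¬ (ws-bv (s≤s z≤n))) (ws-∨ ws-fv (ws-bv (s≤s z≤n))))

theorem2 : ¬ AdmitsQE
    × ¬ (Σ Form λ E → LC E × QF E × (E ⊢ Qex) × (Qex ⊢ E))
theorem2 = no-QE , no-quantifier-free-equivalent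
  where
  no-QE : ¬ AdmitsQE
  no-QE admitsQE with admitsQE Qex Qex-closed
  ... | E , lc , qf , Qex⊢E , E⊢Qex = no-quantifier-free-equivalent (E , lc , qf , E⊢Qex , Qex⊢E)
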